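{- Let $k \ge 4$ and let $G$ be an $SQSR(n, k, 0; k-1, k-2, k-3)$ graph. If $k^2 - 4 \leq n \leq k^2 + 1$, then $k = 4$.
   Context: All graphs are finite and simple. A $QSR(n,k,a;c_1,\ldots,c_p)$ graph is a $k$-regular graph on $n$ vertices such that any two adjacent vertices have exactly $a$ common neighbours and any two distinct non-adjacent vertices have exactly $c_i$ common neighbours for some $1 \le i \le p$. Its grade is the number of indices $i$ for which there actually exist two non-adjacent vertices with exactly $c_i$ common neighbours; it is proper if its grade is $p$. An $SQSR(n,k,a;c_1,\ldots,c_p)$ graph is a proper $QSR(n,k,a;c_1,\ldots,c_p)$ graph in which $a, c_1, \ldots, c_p$ are pairwise distinct. -}

module Defs where

open import Data.Nat using (ℕ; zero; suc; _+_)
open import Data.Bool using (Bool; true; false; _∧_)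
open import Data.Fin using (Fin; zero; suc)
open import Data.Vec using (Vec; lookup)
open import Data.Product using (Σ; ∃; _×_; _,_)
open import Relation.Binary.PropositionalEquality using (_≡_; _≢_)

countFin : (n : ℕ) → (Fin n → Bool) → ℕ
countFin zero    P = 0
countFin (suc n) P with P zero
... | true  = suc (countFin n (λ i → P (suc i)))
... | false = countFin n (λ i → P (suc i))

record Graph (n : ℕ) : Set where
  field
    adj    : Fin n → Fin n → Bool
    sym    : ∀ u v → adj u v ≡ adj v u
    irrefl : ∀ u → adj u u ≡ false
open Graph public

degree : ∀ {n} → Graph n → Fin n → ℕ
degree {n} G u = countFin n (adj G u)

common : ∀ {n} → Graph n → Fin n → Fin n → ℕ
common {n} G u v = countFin n (λ w → adj G u w ∧ adj G v w)

record IsQSR {n : ℕ} (G : Graph n) (k a : ℕ) {p : ℕ} (cs : Vec ℕ p) : Set where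
  field
    regular     : ∀ u → degree G u ≡ k
    adjacentCN  : ∀ u v → adj G u v ≡ true → common G u v ≡ a
    nonadjCN    : ∀ u v → u ≢ v → adj G u v ≡ false →
                  Σ (Fin p) (λ i → common G u v ≡ lookup cs i)

IsProper : ∀ {n} → Graph n → {p : ℕ} → Vec ℕ p → Set
IsProper {n} G {p} cs = ∀ (i : Fin p) →
  Σ (Fin n) (λ u → Σ (Fin n) (λ v →
    (u ≢ v) × (adj G u v ≡ false) × (common G u v ≡ lookup cs i)))

record IsSQSR {n : ℕ} (G : Graph n) (k a : ℕ) {p : ℕ} (cs : Vec ℕ p) : Set where
  field
    qsr      : IsQSR G k a cs
    proper   : IsProper G cs
    a≢c      : ∀ i → a ≢ lookup cs i
    cDistinct : ∀ i j → lookup cs i ≡ lookup cs j → i ≡ j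

{-# OPTIONS --safe #-}
module Submission where

-- Fix a vertex v. Double counting paths of length two from v gives
-- ∑ᵤ |N(v) ∩ N(u)| = k², while each of the n − k non-neighbours u of v
-- (v itself included) shares at least k − 3 neighbours with v. Hence
-- (k − 3)(n − k) ≤ k², which is false for k ≥ 5 once n ≥ k² − 4.

open import Defs hiding (sym)
open import Data.Nat using (ℕ; zero; suc; _≤_; _<_; _+_; _*_; _∸_; z≤n; s≤s)
open import Data.Nat.Properties
open import Data.Nat.Tactic.RingSolver using (solve-∀)
open import Data.Bool using (Bool; true; false; _∧_; not)
open import Data.Bool.Properties using (∧-idem)
open import Data.Fin using (Fin; zero; suc) renaming (_≟_ to _≟ᶠ_)
open import Data.Vec using (Vec; lookup; _∷_; [])
open import Data.Product using (proj₁; _,_)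
open import Data.Sum using (inj₁; inj₂)
open import Data.Empty using (⊥-elim)
open import Function using (_∘_)
open import Relation.Nullary using (yes; no)
open import Relation.Binary.PropositionalEquality
open import Algebra.Properties.CommutativeMonoid.Sum +-0-commutativeMonoid
  using (sum-cong-≗; sum-syntax; ∑-comm)
open import Algebra.Properties.Semiring.Sum +-*-semiring using (*-distribˡ-sum; *-distribʳ-sum)

indicator : Bool → ℕ
indicator true  = 1
indicator false = 0

indicator-∧ : ∀ b c → indicator (b ∧ c) ≡ indicator b * indicator c
indicator-∧ true  c = sym (+-identityʳ (indicator c))
indicator-∧ false c = refl

countFin≡∑indicator : ∀ n P → countFin n P ≡ ∑[ i < n ] indicator (P i)
countFin≡∑indicator zero    P = refl
countFin≡∑indicator (suc n) P with P zero
... | true  = cong suc (countFin≡∑indicator n (P ∘ suc))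
... | false = countFin≡∑indicator n (P ∘ suc)

countFin-cong : ∀ n {P Q : Fin n → Bool} → (∀ i → P i ≡ Q i) → countFin n P ≡ countFin n Q
countFin-cong n {P} {Q} P≗Q = begin
  countFin n P                  ≡⟨ countFin≡∑indicator n P ⟩
  ∑[ i < n ] indicator (P i)    ≡⟨ sum-cong-≗ (cong indicator ∘ P≗Q) ⟩
  ∑[ i < n ] indicator (Q i)    ≡⟨ countFin≡∑indicator n Q ⟨
  countFin n Q                  ∎
  where open ≡-Reasoning

countFin-complement : ∀ n P → countFin n P + countFin n (not ∘ P) ≡ n
countFin-complement zero    P = refl
countFin-complement (suc n) P with P zero
... | true  = cong suc (countFin-complement n (P ∘ suc))
... | false = trans (+-suc _ _) (cong suc (countFin-complement n (P ∘ suc)))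

∑-mono-≤ : ∀ n {f g : Fin n → ℕ} → (∀ i → f i ≤ g i) → ∑[ i < n ] f i ≤ ∑[ i < n ] g i
∑-mono-≤ zero    f≤g = z≤n
∑-mono-≤ (suc n) f≤g = +-mono-≤ (f≤g zero) (∑-mono-≤ n (f≤g ∘ suc))

module _ {n : ℕ} (G : Graph n) where

  common-self : ∀ v → common G v v ≡ degree G v
  common-self v = countFin-cong n (λ w → ∧-idem (adj G v w))

  nonNeighbours≡n∸degree : ∀ v → countFin n (not ∘ adj G v) ≡ n ∸ degree G v
  nonNeighbours≡n∸degree v = begin
    countFin n (not ∘ adj G v)                     ≡⟨ m+n∸m≡n (degree G v) _ ⟨
    degree G v + countFin n (not ∘ adj G v) ∸ degree G v
                                                   ≡⟨ cong (_∸ degree G v) (countFin-complement n (adj G v)) ⟩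
    n ∸ degree G v                                 ∎
    where open ≡-Reasoning

  ∑-common≡k*k : ∀ {k} → (∀ u → degree G u ≡ k) → ∀ v → ∑[ u < n ] common G v u ≡ k * k
  ∑-common≡k*k {k} regular v = begin
    ∑[ u < n ] common G v u
      ≡⟨ sum-cong-≗ (λ u → countFin≡∑indicator n (λ w → adj G v w ∧ adj G u w)) ⟩
    ∑[ u < n ] ∑[ w < n ] indicator (adj G v w ∧ adj G u w)
      ≡⟨ ∑-comm (λ u w → indicator (adj G v w ∧ adj G u w)) ⟩
    ∑[ w < n ] ∑[ u < n ] indicator (adj G v w ∧ adj G u w)
      ≡⟨ sum-cong-≗ (λ w → sum-cong-≗ (λ u → indicator-∧ (adj G v w) (adj G u w))) ⟩
    ∑[ w < n ] ∑[ u < n ] (indicator (adj G v w) * indicator (adj G u w))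
      ≡⟨ sum-cong-≗ (λ w → *-distribˡ-sum (indicator (adj G v w)) (λ u → indicator (adj G u w))) ⟨
    ∑[ w < n ] (indicator (adj G v w) * ∑[ u < n ] indicator (adj G u w))
      ≡⟨ sum-cong-≗ (λ w → cong (indicator (adj G v w) *_) (inDegree≡k w)) ⟩
    ∑[ w < n ] (indicator (adj G v w) * k)
      ≡⟨ *-distribʳ-sum k (indicator ∘ adj G v) ⟨
    (∑[ w < n ] indicator (adj G v w)) * k
      ≡⟨ cong (_* k) (trans (sym (countFin≡∑indicator n (adj G v))) (regular v)) ⟩
    k * k ∎
    where
    open ≡-Reasoning
    inDegree≡k : ∀ w → ∑[ u < n ] indicator (adj G u w) ≡ k
    inDegree≡k w = begin
      ∑[ u < n ] indicator (adj G u w) ≡⟨ sum-cong-≗ (λ u → cong indicator (Graph.sym G u w)) ⟩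
      ∑[ u < n ] indicator (adj G w u) ≡⟨ countFin≡∑indicator n (adj G w) ⟨
      degree G w                        ≡⟨ regular w ⟩
      k                                 ∎

  nonNeighbours-bound : ∀ {k c} → (∀ u → degree G u ≡ k) → ∀ v →
    (∀ u → adj G v u ≡ false → c ≤ common G v u) → c * (n ∸ k) ≤ k * k
  nonNeighbours-bound {k} {c} regular v c≤common = begin
    c * (n ∸ k)                                   ≡⟨ cong (λ d → c * (n ∸ d)) (regular v) ⟨
    c * (n ∸ degree G v)                          ≡⟨ cong (c *_) (nonNeighbours≡n∸degree v) ⟨
    c * countFin n (not ∘ adj G v)                ≡⟨ cong (c *_) (countFin≡∑indicator n (not ∘ adj G v)) ⟩
    c * ∑[ u < n ] indicator (not (adj G v u))    ≡⟨ *-distribˡ-sum c (indicator ∘ not ∘ adj G v) ⟩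
    ∑[ u < n ] (c * indicator (not (adj G v u)))  ≤⟨ ∑-mono-≤ n weighted-bound ⟩
    ∑[ u < n ] common G v u                       ≡⟨ ∑-common≡k*k regular v ⟩
    k * k                                         ∎
    where
    open ≤-Reasoning
    weighted-bound : ∀ u → c * indicator (not (adj G v u)) ≤ common G v u
    weighted-bound u with adj G v u in v≁u
    ... | true  = ≤-trans (≤-reflexive (*-zeroʳ c)) z≤n
    ... | false = ≤-trans (≤-reflexive (*-identityʳ c)) (c≤common u v≁u)

nonNeighbour-common-≥ : ∀ {n k a c p} {G : Graph n} {cs : Vec ℕ p} → IsQSR G k a cs →
  c ≤ k → (∀ i → c ≤ lookup cs i) → ∀ v u → adj G v u ≡ false → c ≤ common G v u
nonNeighbour-common-≥ {G = G} qsr c≤k c≤cs v u v≁u with u ≟ᶠ v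
... | yes refl = ≤-trans c≤k (≤-reflexive (sym (trans (common-self G v) (IsQSR.regular qsr v))))
... | no u≢v with IsQSR.nonadjCN qsr v u (u≢v ∘ sym) v≁u
...   | i , common≡cᵢ = ≤-trans (c≤cs i) (≤-reflexive (sym common≡cᵢ))

k∸3≤lookup : ∀ k i → k ∸ 3 ≤ lookup (k ∸ 1 ∷ k ∸ 2 ∷ k ∸ 3 ∷ []) i
k∸3≤lookup k zero             = ∸-monoʳ-≤ k (s≤s z≤n)
k∸3≤lookup k (suc zero)       = ∸-monoʳ-≤ k (s≤s (s≤s z≤n))
k∸3≤lookup k (suc (suc zero)) = ≤-refl

square<cubic : ∀ {k} → 5 ≤ k → k * k < (k ∸ 3) * (k * k ∸ 4 ∸ k)
square<cubic (s≤s (s≤s (s≤s (s≤s (s≤s (z≤n {m})))))) = begin-strict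
  k * k                                     <⟨ m<m+n (k * k) (s≤s z≤n) ⟩
  k * k + suc (m * m * m + 10 * (m * m) + 24 * m + 6)
                                            ≡⟨ cubic-expansion m ⟨
  (2 + m) * q                               ≡⟨ cong ((2 + m) *_) (m+n∸m≡n k q) ⟨
  (2 + m) * (k + q ∸ k)                     ≡⟨ cong (λ x → (2 + m) * (x ∸ 4 ∸ k)) (square-split m) ⟨
  (2 + m) * (k * k ∸ 4 ∸ k)                 ∎
  where
  open ≤-Reasoning
  k q : ℕ
  k = 5 + m
  q = m * m + 9 * m + 16
  square-split : ∀ m → (5 + m) * (5 + m) ≡ 4 + ((5 + m) + (m * m + 9 * m + 16))
  square-split = solve-∀
  -- with k = 5 + m: (k − 3)(k² − 4 − k) − k² = m³ + 10m² + 24m + 7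
  cubic-expansion : ∀ m → (2 + m) * (m * m + 9 * m + 16)
                        ≡ (5 + m) * (5 + m) + suc (m * m * m + 10 * (m * m) + 24 * m + 6)
  cubic-expansion = solve-∀

mainTheorem5 : (n k : ℕ) → 4 ≤ k → (G : Graph n) →
    IsSQSR G k 0 ((k ∸ 1) ∷ (k ∸ 2) ∷ (k ∸ 3) ∷ []) →
    (k * k) ∸ 4 ≤ n → n ≤ (k * k) + 1 → k ≡ 4
mainTheorem5 n k 4≤k G sqsr k*k∸4≤n _ with m≤n⇒m<n∨m≡n 4≤k
... | inj₂ 4≡k = sym 4≡k
... | inj₁ 5≤k = ⊥-elim (<⇒≱ (square<cubic 5≤k) (begin
  (k ∸ 3) * (k * k ∸ 4 ∸ k)  ≤⟨ *-monoʳ-≤ (k ∸ 3) (∸-monoˡ-≤ k k*k∸4≤n) ⟩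
  (k ∸ 3) * (n ∸ k)          ≤⟨ nonNeighbours-bound G regular v k∸3≤common ⟩
  k * k                      ∎))
  where
  open ≤-Reasoning
  open IsSQSR sqsr
  open IsQSR qsr
  v : Fin n
  v = proj₁ (proper zero)
  k∸3≤common : ∀ u → adj G v u ≡ false → k ∸ 3 ≤ common G v u
  k∸3≤common = nonNeighbour-common-≥ qsr (m∸n≤m k 3) (k∸3≤lookup k) v
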